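{- Every bi-infinite binary $\tfrac{11}{3}$-free word $\mathbf w$ containing no pair of complementary factors of length $4$ (i.e. there is no word $x$ of length $4$ with both $x$ and $\overline{x}$ factors of $\mathbf w$) has the same set of factors as $h(\mathbf f)$ or the same set of factors as $\overline{h(\mathbf f)}$.
   Context: $\overline{x}$ denotes the image of $x$ under exchanging $0$ and $1$. A bi-infinite word is a map $\mathbb Z\to\{0,1\}$; its factors are its finite contiguous subwords. For a finite word $w$, $\exp(w)=|w|/\mathrm{per}(w)$ with $\mathrm{per}(w)$ its smallest period; a word is $\beta$-free if every nonempty factor has exponent $<\beta$. $\mathbf f$ is the Fibonacci word, fixed point of $0\mapsto01$, $1\mapsto0$, and $h$ is the morphism $0\mapsto0$, $1\mapsto01$. -}

module Defs where

open import Data.Empty using (⊥)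
open import Data.Bool using (Bool; true; false; not)
open import Data.Nat using (ℕ; zero; suc; _+_; _*_; _≤_; _<_)
open import Data.Integer as ℤ using (ℤ)
open import Data.List using (List; []; _∷_; _++_; length; map; concatMap)
open import Data.Maybe using (Maybe; just; nothing; fromMaybe)
open import Data.Product using (Σ; _×_; ∃)
open import Relation.Binary.PropositionalEquality using (_≡_)
open import Function.Bundles using (_⇔_)

-- Letters: false = 0, true = 1.
Word : Set
Word = List Bool

BiWord : Set
BiWord = ℤ → Bool

InfWord : Set
InfWord = ℕ → Bool

compl : Word → Word
compl = map not

complInf : InfWord → InfWord
complInf x i = not (x i)

windowZ : BiWord → ℤ → ℕ → Word
windowZ w i zero = []
windowZ w i (suc n) = w i ∷ windowZ w (i ℤ.+ ℤ.+ 1) n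

windowN : InfWord → ℕ → ℕ → Word
windowN w i zero = []
windowN w i (suc n) = w i ∷ windowN w (suc i) n

FactorZ : BiWord → Word → Set
FactorZ w u = ∃ λ (i : ℤ) → windowZ w i (length u) ≡ u

FactorN : InfWord → Word → Set
FactorN w u = ∃ λ (i : ℕ) → windowN w i (length u) ≡ u

nth : Word → ℕ → Maybe Bool
nth [] _ = nothing
nth (a ∷ u) zero = just a
nth (a ∷ u) (suc i) = nth u i

IsPeriod : Word → ℕ → Set
IsPeriod u p = (0 < p) × (∀ i → i + p < length u → nth u i ≡ nth u (i + p))

IsSmallestPeriod : Word → ℕ → Set
IsSmallestPeriod u p = IsPeriod u p × (∀ q → IsPeriod u q → p ≤ q)

-- every nonempty factor u has exp(u) = |u|/per(u) < 11/3, i.e. 3|u| < 11 per(u)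
ElevenThirdsFree : BiWord → Set
ElevenThirdsFree w = ∀ u p → FactorZ w u → 0 < length u → IsSmallestPeriod u p →
  3 * length u < 11 * p

NoComplementaryPairs4 : BiWord → Set
NoComplementaryPairs4 w = ∀ x → length x ≡ 4 → FactorZ w x → FactorZ w (compl x) → ⊥

φ-letter : Bool → Word
φ-letter false = false ∷ true ∷ []
φ-letter true = false ∷ []

φ : Word → Word
φ = concatMap φ-letter

h-letter : Bool → Word
h-letter false = false ∷ []
h-letter true = false ∷ true ∷ []

h : Word → Word
h = concatMap h-letter

φ^ : ℕ → Word
φ^ zero = false ∷ []
φ^ (suc n) = φ (φ^ n)

-- The Fibonacci word f = lim φ^n(0): φ^n(0) is a prefix of f of length ≥ n+1,
-- so letter i of f is letter i of φ^(i)(0) (the default is never used).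
fib : InfWord
fib i = fromMaybe false (nth (φ^ i) i)

-- h(f): h(φ^n(0)) is a prefix of h(f) of length ≥ n+1.
hfib : InfWord
hfib i = fromMaybe false (nth (h (φ^ i)) i)

SameFactors : BiWord → InfWord → Set
SameFactors w x = ∀ u → FactorZ w u ⇔ FactorN x u

module Submission where

-- Eight consecutive letters of w contain 00 or 11, since (01)⁴ has exponent 4 ≥ 11/3; up to
-- complementation w contains 00. Then w contains no 11 (by complementation, the 00 may be taken to
-- come first): at distance at most 7 this is excluded by an exhaustive search (with 12 free letters
-- on each side, every filling has a factor of exponent ≥ 11/3 or two complementary factors of
-- length 4), and at a larger distance the eight letters after the 00 contain a 00 or 11 closer to
-- one of the two. So w is a concatenation of h(0) = 0 and h(1) = 01, and desubstituting along φ it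
-- is, for every N, a bi-infinite concatenation of the blocks h(φᴺ(0)), h(φᴺ(1)) whose sequence of
-- letters avoids 11: h(φᴺ(11ab)) begins with the fourth power of h(φᴺ⁻¹(0)) for N ≥ 3 and is
-- checked directly otherwise. Hence every factor of w lies in some h(φᴺ(ab)) with ab ∈ {00, 01,
-- 10}, a factor of h(f), and conversely every prefix h(φᴺ(0)) of h(f) occurs in w.

open import Defs
open import Data.Bool using (Bool; true; false; not; _∧_; _∨_; T)
open import Data.Bool.Properties using (not-involutive; ¬-not; T?; T-∨; T-∧; T-≡)
import Data.Bool as Bool
open import Data.Empty using (⊥; ⊥-elim)
open import Data.Unit using (⊤)
open import Data.Integer as ℤ using (ℤ)
import Data.Integer.Properties as ℤ
open import Data.List using (List; []; _∷_; _++_; [_]; length; drop; map; replicate)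
open import Data.List.Properties using (length-++; ++-assoc; ++-identityʳ; length-map; concatMap-++; ∷-injective)
open import Data.Maybe using (Maybe; just; nothing; fromMaybe)
import Data.Maybe
open import Data.Nat using (ℕ; zero; suc; _+_; _*_; _∸_; _≤_; _<_; _≤ᵇ_; z≤n; s≤s; s<s⁻¹)
open import Data.Nat.Properties
open import Data.Product using (_×_; _,_; ∃; ∃₂; proj₁; proj₂; map₂; uncurry)
open import Data.Sum using (_⊎_; inj₁; inj₂)
open import Relation.Binary.PropositionalEquality hiding ([_])
open import Function.Bundles using (mk⇔; Equivalence)
open import Relation.Nullary using (¬_; Dec; yes; no; contradiction)
open import Data.Nat.Induction using (<-rec)
open import Data.Nat.Tactic.RingSolver using (solve-∀)
open import Relation.Unary using (Decidable)
open import Function using (_∘_)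
open import Relation.Nullary.Decidable using (⌊_⌋)
open import Data.Maybe.Properties using (just-injective)

infixl 6 _⊕_ _⊖_

_⊕_ : ℤ → ℕ → ℤ
i ⊕ n = i ℤ.+ ℤ.+ n

_⊖_ : ℤ → ℕ → ℤ
i ⊖ n = i ℤ.- ℤ.+ n

⊕-identityʳ : ∀ i → i ⊕ 0 ≡ i
⊕-identityʳ = ℤ.+-identityʳ

⊕-assoc : ∀ i m n → i ⊕ m ⊕ n ≡ i ⊕ (m + n)
⊕-assoc i m n = ℤ.+-assoc i (ℤ.+ m) (ℤ.+ n)

⊕-suc : ∀ i n → i ⊕ n ⊕ 1 ≡ i ⊕ suc n
⊕-suc i n = trans (⊕-assoc i n 1) (cong (_⊕_ i) (+-comm n 1))

⊖-⊕-inverse : ∀ i n → i ⊖ n ⊕ n ≡ i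
⊖-⊕-inverse i n = begin
  i ℤ.- ℤ.+ n ℤ.+ ℤ.+ n     ≡⟨ ℤ.+-assoc i (ℤ.- ℤ.+ n) (ℤ.+ n) ⟩
  i ℤ.+ (ℤ.- ℤ.+ n ℤ.+ ℤ.+ n) ≡⟨ cong (ℤ._+_ i) (ℤ.+-inverseˡ (ℤ.+ n)) ⟩
  i ℤ.+ ℤ.0ℤ                 ≡⟨ ℤ.+-identityʳ i ⟩
  i                          ∎
  where open ≡-Reasoning

⊖-⊕-+ : ∀ p n k → p ⊖ n ⊕ (n + k) ≡ p ⊕ k
⊖-⊕-+ p n k = trans (sym (⊕-assoc (p ⊖ n) n k)) (cong (_⊕ k) (⊖-⊕-inverse p n))

i+[j-i]≡j : ∀ i j → i ℤ.+ (j ℤ.- i) ≡ j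
i+[j-i]≡j i j = begin
  i ℤ.+ (j ℤ.- i)     ≡⟨ cong (ℤ._+_ i) (ℤ.+-comm j (ℤ.- i)) ⟩
  i ℤ.+ (ℤ.- i ℤ.+ j) ≡⟨ ℤ.+-assoc i (ℤ.- i) j ⟨
  i ℤ.- i ℤ.+ j       ≡⟨ cong (ℤ._+ j) (ℤ.+-inverseʳ i) ⟩
  ℤ.0ℤ ℤ.+ j          ≡⟨ ℤ.+-identityˡ j ⟩
  j                   ∎
  where open ≡-Reasoning

⊕-total : ∀ p q → (∃ λ d → q ≡ p ⊕ d) ⊎ (∃ λ d → p ≡ q ⊕ d)
⊕-total p q with q ℤ.- p | i+[j-i]≡j p q
... | ℤ.+ d | p⊕d≡q = inj₁ (d , sym p⊕d≡q)
... | ℤ.-[1+ d ] | p⊖1+d≡q = inj₂ (suc d , trans (sym (⊖-⊕-inverse p (suc d))) (cong (_⊕ suc d) p⊖1+d≡q))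

++-injective : ∀ {A : Set} (xs us : List A) {ys vs} → length xs ≡ length us →
  xs ++ ys ≡ us ++ vs → xs ≡ us × ys ≡ vs
++-injective [] [] _ eq = refl , eq
++-injective (x ∷ xs) (u ∷ us) ∣xs∣≡∣us∣ eq with ∷-injective eq
... | refl , eq′ with ++-injective xs us (suc-injective ∣xs∣≡∣us∣) eq′
...   | refl , ys≡vs = refl , ys≡vs

++-cancel-middle : ∀ {A : Set} (xs us : List A) {ys vs zs ws} → length xs ≡ length us → length ys ≡ length vs →
  xs ++ ys ++ zs ≡ us ++ vs ++ ws → ys ≡ vs
++-cancel-middle xs us ∣xs∣≡∣us∣ ∣ys∣≡∣vs∣ eq = proj₁ (++-injective _ _ ∣ys∣≡∣vs∣ (proj₂ (++-injective xs us ∣xs∣≡∣us∣ eq)))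

length-++₃ : ∀ (s u t : Word) → length (s ++ u ++ t) ≡ length s + length u + length t
length-++₃ s u t = trans (length-++ s) (trans (cong (length s +_) (length-++ u)) (sym (+-assoc (length s) _ _)))

nth-++ˡ : ∀ (u v : Word) {i} → i < length u → nth (u ++ v) i ≡ nth u i
nth-++ˡ (a ∷ u) v {zero} _ = refl
nth-++ˡ (a ∷ u) v {suc i} (s≤s i<n) = nth-++ˡ u v i<n

nth-++ʳ : ∀ (u v : Word) i → nth (u ++ v) (length u + i) ≡ nth v i
nth-++ʳ [] v i = refl
nth-++ʳ (a ∷ u) v i = nth-++ʳ u v i

nth-drop : ∀ (u : Word) p i → nth (drop p u) i ≡ nth u (p + i)
nth-drop [] zero i = refl
nth-drop [] (suc p) i = refl
nth-drop (a ∷ u) zero i = refl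
nth-drop (a ∷ u) (suc p) i = nth-drop u p i

length-drop : ∀ (u : Word) p → length (drop p u) ≡ length u ∸ p
length-drop [] zero = refl
length-drop [] (suc p) = refl
length-drop (a ∷ u) zero = refl
length-drop (a ∷ u) (suc p) = length-drop u p

Infix : Word → Word → Set
Infix u v = ∃₂ λ s t → v ≡ s ++ u ++ t

infix-trans : ∀ {u v x} → Infix u v → Infix v x → Infix u x
infix-trans {u} (s , t , refl) (s′ , t′ , refl) =
  s′ ++ s , t ++ t′ , trans (cong (s′ ++_) (trans (++-assoc s (u ++ t) t′) (cong (s ++_) (++-assoc u t t′))))
                            (sym (++-assoc s′ s (u ++ t ++ t′)))

length-windowZ : ∀ (w : BiWord) i n → length (windowZ w i n) ≡ n
length-windowZ w i zero = refl
length-windowZ w i (suc n) = cong suc (length-windowZ w (i ⊕ 1) n)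

windowZ-+ : ∀ (w : BiWord) i m n → windowZ w i (m + n) ≡ windowZ w i m ++ windowZ w (i ⊕ m) n
windowZ-+ w i zero n = cong (λ j → windowZ w j n) (sym (⊕-identityʳ i))
windowZ-+ w i (suc m) n = cong (w i ∷_) (trans (windowZ-+ w (i ⊕ 1) m n)
  (cong (λ j → windowZ w (i ⊕ 1) m ++ windowZ w j n) (⊕-assoc i 1 m)))

nth-windowZ : ∀ (w : BiWord) i {n k} → k < n → nth (windowZ w i n) k ≡ just (w (i ⊕ k))
nth-windowZ w i {suc n} {zero} _ = cong (just ∘ w) (sym (⊕-identityʳ i))
nth-windowZ w i {suc n} {suc k} (s≤s k<n) = trans (nth-windowZ w (i ⊕ 1) k<n) (cong (λ j → just (w j)) (⊕-assoc i 1 k))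

windowZ-+₃ : ∀ (w : BiWord) i d L r →
  windowZ w i (d + L + r) ≡ windowZ w i d ++ windowZ w (i ⊕ d) L ++ windowZ w (i ⊕ d ⊕ L) r
windowZ-+₃ w i d L r = trans (cong (windowZ w i) (+-assoc d L r))
  (trans (windowZ-+ w i d (L + r)) (cong (windowZ w i d ++_) (windowZ-+ w (i ⊕ d) L r)))

windowZ-infix : ∀ (w : BiWord) i d L r → Infix (windowZ w (i ⊕ d) L) (windowZ w i (d + L + r))
windowZ-infix w i d L r = windowZ w i d , windowZ w (i ⊕ d ⊕ L) r , windowZ-+₃ w i d L r

factorZ-window : ∀ (w : BiWord) i n → FactorZ w (windowZ w i n)
factorZ-window w i n = i , cong (windowZ w i) (length-windowZ w i n)

factorZ-infix : ∀ {w u v} → FactorZ w v → Infix u v → FactorZ w u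
factorZ-infix {w} {u} (i , occ) (s , t , refl) =
  i ⊕ length s , ++-cancel-middle (windowZ w i (length s)) s (length-windowZ w i (length s)) (length-windowZ w _ (length u))
    (trans (sym (windowZ-+₃ w i (length s) (length u) (length t))) (trans (cong (windowZ w i) (sym (length-++₃ s u t))) occ))

factorZ-++ˡ : ∀ {w u v} → FactorZ w (u ++ v) → FactorZ w u
factorZ-++ˡ {v = v} fuv = factorZ-infix fuv ([] , v , refl)

factorZ-++ʳ : ∀ {w} u {v} → FactorZ w (u ++ v) → FactorZ w v
factorZ-++ʳ u {v} fuv = factorZ-infix fuv (u , [] , cong (u ++_) (sym (++-identityʳ v)))

OccursAt : BiWord → ℤ → Word → Set
OccursAt w i v = windowZ w i (length v) ≡ v

occursAt-++ : ∀ {w i} u {v} → OccursAt w i u → OccursAt w (i ⊕ length u) v → OccursAt w i (u ++ v)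
occursAt-++ {w} {i} u {v} occ₁ occ₂ =
  trans (cong (windowZ w i) (length-++ u)) (trans (windowZ-+ w i (length u) (length v)) (cong₂ _++_ occ₁ occ₂))

windowN-+ : ∀ (x : InfWord) i m n → windowN x i (m + n) ≡ windowN x i m ++ windowN x (i + m) n
windowN-+ x i zero n = cong (λ j → windowN x j n) (sym (+-identityʳ i))
windowN-+ x i (suc m) n = cong (x i ∷_) (trans (windowN-+ x (suc i) m n) (cong (λ j → windowN x (suc i) m ++ windowN x j n) (sym (+-suc i m))))

length-windowN : ∀ (x : InfWord) i n → length (windowN x i n) ≡ n
length-windowN x i zero = refl
length-windowN x i (suc n) = cong suc (length-windowN x (suc i) n)

windowN-+₃ : ∀ (x : InfWord) i d L r →
  windowN x i (d + L + r) ≡ windowN x i d ++ windowN x (i + d) L ++ windowN x (i + d + L) r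
windowN-+₃ x i d L r = trans (cong (windowN x i) (+-assoc d L r))
  (trans (windowN-+ x i d (L + r)) (cong (windowN x i d ++_) (windowN-+ x (i + d) L r)))

windowN-infix : ∀ (x : InfWord) i d L r → Infix (windowN x (i + d) L) (windowN x i (d + L + r))
windowN-infix x i d L r = windowN x i d , windowN x (i + d + L) r , windowN-+₃ x i d L r

windowN-prefix-infix : ∀ (x : InfWord) {u V} → windowN x 0 (length V) ≡ V → Infix u V → FactorN x u
windowN-prefix-infix x {u} prefix (s , t , refl) =
  length s , ++-cancel-middle (windowN x 0 (length s)) s (length-windowN x 0 (length s)) (length-windowN x _ (length u))
    (trans (sym (windowN-+₃ x 0 (length s) (length u) (length t))) (trans (cong (windowN x 0) (sym (length-++₃ s u t))) prefix))

windowN-nth : ∀ (x : InfWord) i v → (∀ j → j < length v → nth v j ≡ just (x (i + j))) → windowN x i (length v) ≡ v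
windowN-nth x i [] _ = refl
windowN-nth x i (a ∷ v) agree = cong₂ _∷_
  (just-injective (trans (cong (just ∘ x) (sym (+-identityʳ i))) (sym (agree 0 (s≤s z≤n)))))
  (windowN-nth x (suc i) v λ j j<n → trans (agree (suc j) (s≤s j<n)) (cong (just ∘ x) (+-suc i j)))

isPrefixᵇ : Word → Word → Bool
isPrefixᵇ [] _ = true
isPrefixᵇ (_ ∷ _) [] = false
isPrefixᵇ (a ∷ u) (b ∷ v) = ⌊ a Bool.≟ b ⌋ ∧ isPrefixᵇ u v

isPrefixᵇ-sound : ∀ u v → T (isPrefixᵇ u v) → ∃ λ t → v ≡ u ++ t
isPrefixᵇ-sound [] v _ = v , refl
isPrefixᵇ-sound (a ∷ u) (b ∷ v) pre with a Bool.≟ b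
... | yes refl = map₂ (cong (a ∷_)) (isPrefixᵇ-sound u v pre)

isPrefixᵇ-complete : ∀ u v → length u ≤ length v → (∀ i → i < length u → nth u i ≡ nth v i) →
  T (isPrefixᵇ u v)
isPrefixᵇ-complete [] v _ _ = _
isPrefixᵇ-complete (a ∷ u) (b ∷ v) (s≤s ∣u∣≤∣v∣) agree with a Bool.≟ b
... | yes _ = isPrefixᵇ-complete u v ∣u∣≤∣v∣ (λ i i<n → agree (suc i) (s≤s i<n))
... | no a≢b = contradiction (just-injective (agree 0 (s≤s z≤n))) a≢b

isPeriodᵇ : Word → ℕ → Bool
isPeriodᵇ u p = isPrefixᵇ (drop p u) u

isPeriodᵇ-sound : ∀ u {p} → 0 < p → T (isPeriodᵇ u p) → IsPeriod u p
isPeriodᵇ-sound u {p} p>0 pre with isPrefixᵇ-sound (drop p u) u pre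
... | t , u≡ = p>0 , λ i i+p<n → sym (begin
  nth u (i + p)            ≡⟨ cong (nth u) (+-comm i p) ⟩
  nth u (p + i)            ≡⟨ nth-drop u p i ⟨
  nth (drop p u) i         ≡⟨ nth-++ˡ (drop p u) t (i<∣drop∣ i+p<n) ⟨
  nth (drop p u ++ t) i    ≡⟨ cong (λ v → nth v i) u≡ ⟨
  nth u i                  ∎)
  where
  open ≡-Reasoning
  i<∣drop∣ : ∀ {i} → i + p < length u → i < length (drop p u)
  i<∣drop∣ {i} i+p<n = subst (i <_) (sym (length-drop u p))
    (subst (_< length u ∸ p) (m+n∸n≡m i p) (∸-monoˡ-< i+p<n (m≤n+m p i)))

isPeriodᵇ-complete : ∀ u {p} → IsPeriod u p → T (isPeriodᵇ u p)
isPeriodᵇ-complete u {p} (_ , per) = isPrefixᵇ-complete (drop p u) u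
  (subst (_≤ length u) (sym (length-drop u p)) (m∸n≤m (length u) p))
  (λ i i<n → begin
    nth (drop p u) i   ≡⟨ nth-drop u p i ⟩
    nth u (p + i)      ≡⟨ cong (nth u) (+-comm p i) ⟩
    nth u (i + p)      ≡⟨ per i (i+p<∣u∣ i (subst (i <_) (length-drop u p) i<n)) ⟨
    nth u i            ∎)
  where
  open ≡-Reasoning
  i+p<∣u∣ : ∀ i {n} → i < n ∸ p → i + p < n
  i+p<∣u∣ i {n} i<n∸p = subst (i + p <_) (m∸n+n≡m {n} {p} (<⇒≤ (m∸n≢0⇒n<m {n} (m<n⇒n≢0 i<n∸p)))) (+-monoˡ-< p i<n∸p)

module _ {P : ℕ → Set} (P? : Decidable P) where

  least-below : ∀ n → (∃ λ p → p < n × P p × (∀ r → r < p → ¬ P r)) ⊎ (∀ r → r < n → ¬ P r)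
  least-below zero = inj₂ (λ _ ())
  least-below (suc n) with least-below n
  ... | inj₁ (p , p<n , Pp , below) = inj₁ (p , m<n⇒m<1+n p<n , Pp , below)
  ... | inj₂ none with P? n
  ...   | yes Pn = inj₁ (n , ≤-refl , Pn , none)
  ...   | no ¬Pn = inj₂ λ r r<1+n → none′ (m<1+n⇒m<n∨m≡n r<1+n)
    where
    none′ : ∀ {r} → r < n ⊎ r ≡ n → ¬ P r
    none′ (inj₁ r<n) = none _ r<n
    none′ (inj₂ refl) = ¬Pn

  minimal : ∀ {q} → P q → ∃ λ p → P p × (∀ r → P r → p ≤ r)
  minimal {q} Pq with least-below (suc q)
  ... | inj₁ (p , _ , Pp , below) = p , Pp , λ r Pr → ≮⇒≥ (λ r<p → below r r<p Pr)
  ... | inj₂ none = contradiction Pq (none q ≤-refl)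

isPeriod? : ∀ u p → Dec (IsPeriod u p)
isPeriod? u p with 0 <? p | T? (isPeriodᵇ u p)
... | no p≯0 | _ = no (p≯0 ∘ proj₁)
... | yes p>0 | yes per = yes (isPeriodᵇ-sound u p>0 per)
... | yes _ | no ¬per = no (¬per ∘ isPeriodᵇ-complete u)

period-bound : ∀ {w} → ElevenThirdsFree w → ∀ {x q} → FactorZ w x → IsPeriod x q → 3 * length x < 11 * q
period-bound free {[]} _ (q>0 , _) = *-monoʳ-< 11 q>0
period-bound free {x@(_ ∷ _)} {q} fx per with minimal (isPeriod? x) per
... | p , smallest@(_ , least) = <-≤-trans (free x p fx (s≤s z≤n) smallest) (*-monoʳ-≤ 11 (least q per))

overlap⇒isPeriod : ∀ x v t → 0 < length x → v ++ t ≡ x ++ v → IsPeriod (x ++ v) (length x)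
overlap⇒isPeriod x v t ∣x∣>0 v++t≡x++v = ∣x∣>0 , λ i i+∣x∣<n → sym (begin
  nth (x ++ v) (i + length x)  ≡⟨ cong (nth (x ++ v)) (+-comm i (length x)) ⟩
  nth (x ++ v) (length x + i)  ≡⟨ nth-++ʳ x v i ⟩
  nth v i                      ≡⟨ nth-++ˡ v t (i<∣v∣ i+∣x∣<n) ⟨
  nth (v ++ t) i               ≡⟨ cong (λ u → nth u i) v++t≡x++v ⟩
  nth (x ++ v) i               ∎)
  where
  open ≡-Reasoning
  i<∣v∣ : ∀ {i} → i + length x < length (x ++ v) → i < length v
  i<∣v∣ {i} lt = +-cancelʳ-< (length x) i (length v) (subst (i + length x <_) (trans (length-++ x) (+-comm (length x) (length v))) lt)

fourth-power-forbidden : ∀ {w} → ElevenThirdsFree w → ∀ K r → 0 < length K → ¬ FactorZ w (K ++ K ++ K ++ K ++ r)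
fourth-power-forbidden {w} free K r ∣K∣>0 f = <⇒≱ (period-bound free fK⁴ (overlap⇒isPeriod K K³ K ∣K∣>0 K³++K≡K++K³)) 11k≤3∣K⁴∣
  where
  K³ : Word
  K³ = K ++ K ++ K
  K³++K≡K++K³ : K³ ++ K ≡ K ++ K³
  K³++K≡K++K³ = trans (++-assoc K (K ++ K) K) (cong (K ++_) (++-assoc K K K))
  fK⁴ : FactorZ w (K ++ K³)
  fK⁴ = factorZ-++ˡ (subst (FactorZ w) K⁴++r f)
    where
    K⁴++r : K ++ K ++ K ++ K ++ r ≡ (K ++ K³) ++ r
    K⁴++r = sym (trans (++-assoc K K³ r) (cong (K ++_) (trans (++-assoc K (K ++ K) r) (cong (K ++_) (++-assoc K K r)))))
  11k≤3∣K⁴∣ : 11 * length K ≤ 3 * length (K ++ K³)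
  11k≤3∣K⁴∣ = subst (λ n → 11 * length K ≤ 3 * n) (sym ∣K⁴∣) (subst (11 * length K ≤_) (12k≡ (length K)) (m≤m+n (11 * length K) (length K)))
    where
    ∣K⁴∣ : length (K ++ K³) ≡ length K + (length K + (length K + length K))
    ∣K⁴∣ = trans (length-++ K) (cong (length K +_) (trans (length-++ K) (cong (length K +_) (length-++ K))))
    12k≡ : ∀ k → 11 * k + k ≡ 3 * (k + (k + (k + k)))
    12k≡ = solve-∀

complZ : BiWord → BiWord
complZ w i = not (w i)

compl-involutive : ∀ u → compl (compl u) ≡ u
compl-involutive [] = refl
compl-involutive (a ∷ u) = cong₂ _∷_ (not-involutive a) (compl-involutive u)

length-compl : ∀ u → length (compl u) ≡ length u
length-compl = length-map not

windowZ-compl : ∀ w i n → windowZ (complZ w) i n ≡ compl (windowZ w i n)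
windowZ-compl w i zero = refl
windowZ-compl w i (suc n) = cong (not (w i) ∷_) (windowZ-compl w (i ⊕ 1) n)

windowN-compl : ∀ x i n → windowN (complInf x) i n ≡ compl (windowN x i n)
windowN-compl x i zero = refl
windowN-compl x i (suc n) = cong (not (x i) ∷_) (windowN-compl x (suc i) n)

factorZ-compl : ∀ {w u} → FactorZ w u → FactorZ (complZ w) (compl u)
factorZ-compl {w} {u} (i , occ) =
  i , trans (cong (windowZ (complZ w) i) (length-compl u)) (trans (windowZ-compl w i (length u)) (cong compl occ))

factorZ-compl⁻ : ∀ {w u} → FactorZ (complZ w) u → FactorZ w (compl u)
factorZ-compl⁻ {w} {u} (i , occ) = i , (begin
  windowZ w i (length (compl u))         ≡⟨ cong (windowZ w i) (length-compl u) ⟩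
  windowZ w i (length u)                 ≡⟨ compl-involutive _ ⟨
  compl (compl (windowZ w i (length u))) ≡⟨ cong compl (windowZ-compl w i (length u)) ⟨
  compl (windowZ (complZ w) i (length u)) ≡⟨ cong compl occ ⟩
  compl u                                ∎)
  where open ≡-Reasoning

nth-compl : ∀ u i → nth (compl u) i ≡ Data.Maybe.map not (nth u i)
nth-compl [] i = refl
nth-compl (a ∷ u) zero = refl
nth-compl (a ∷ u) (suc i) = nth-compl u i

isPeriod-compl : ∀ {u p} → IsPeriod u p → IsPeriod (compl u) p
isPeriod-compl {u} {p} (p>0 , per) = p>0 , λ i i+p<n → begin
  nth (compl u) i                    ≡⟨ nth-compl u i ⟩
  Data.Maybe.map not (nth u i)       ≡⟨ cong (Data.Maybe.map not) (per i (subst (i + p <_) (length-compl u) i+p<n)) ⟩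
  Data.Maybe.map not (nth u (i + p)) ≡⟨ nth-compl u (i + p) ⟨
  nth (compl u) (i + p)              ∎
  where open ≡-Reasoning

isPeriod-compl⁻ : ∀ {u p} → IsPeriod (compl u) p → IsPeriod u p
isPeriod-compl⁻ {u} {p} per = subst (λ v → IsPeriod v p) (compl-involutive u) (isPeriod-compl {compl u} per)

elevenThirdsFree-compl : ∀ {w} → ElevenThirdsFree w → ElevenThirdsFree (complZ w)
elevenThirdsFree-compl free u p fu ∣u∣>0 (per , least) = subst (λ l → 3 * l < 11 * p) (length-compl u)
  (free (compl u) p (factorZ-compl⁻ fu) (subst (0 <_) (sym (length-compl u)) ∣u∣>0)
    (isPeriod-compl {u} per , λ q per′ → least q (isPeriod-compl⁻ {u} per′)))

noComplementaryPairs4-compl : ∀ {w} → NoComplementaryPairs4 w → NoComplementaryPairs4 (complZ w)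
noComplementaryPairs4-compl noPairs x ∣x∣≡4 fx fx̄ =
  noPairs (compl x) (trans (length-compl x) ∣x∣≡4) (factorZ-compl⁻ fx) (factorZ-compl⁻ fx̄)

sameFactors-compl : ∀ {w} x → SameFactors (complZ w) x → SameFactors w (complInf x)
sameFactors-compl {w} x same u = mk⇔ to from
  where
  to : FactorZ w u → FactorN (complInf x) u
  to fu with Equivalence.to (same (compl u)) (factorZ-compl fu)
  ... | i , occ = i , (begin
    windowN (complInf x) i (length u)  ≡⟨ windowN-compl x i (length u) ⟩
    compl (windowN x i (length u))     ≡⟨ cong (compl ∘ windowN x i) (length-compl u) ⟨
    compl (windowN x i (length (compl u))) ≡⟨ cong compl occ ⟩
    compl (compl u)                    ≡⟨ compl-involutive u ⟩
    u                                  ∎)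
    where open ≡-Reasoning
  from : FactorN (complInf x) u → FactorZ w u
  from (i , occ) = subst (FactorZ w) (compl-involutive u)
    (factorZ-compl⁻ (Equivalence.from (same (compl u)) (i , (begin
      windowN x i (length (compl u))         ≡⟨ cong (windowN x i) (length-compl u) ⟩
      windowN x i (length u)                 ≡⟨ compl-involutive _ ⟨
      compl (compl (windowN x i (length u))) ≡⟨ cong compl (windowN-compl x i (length u)) ⟨
      compl (windowN (complInf x) i (length u)) ≡⟨ cong compl occ ⟩
      compl u                                ∎))))
    where open ≡-Reasoning

anySuffixᵇ : (Word → Bool) → Word → Bool
anySuffixᵇ f [] = f []
anySuffixᵇ f (a ∷ v) = f (a ∷ v) ∨ anySuffixᵇ f v

anySuffixᵇ-sound : ∀ f v → T (anySuffixᵇ f v) → ∃₂ λ s x → v ≡ s ++ x × T (f x)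
anySuffixᵇ-sound f [] fx = [] , [] , refl , fx
anySuffixᵇ-sound f (a ∷ v) any with Equivalence.to T-∨ any
... | inj₁ fx = [] , a ∷ v , refl , fx
... | inj₂ any′ with anySuffixᵇ-sound f v any′
...   | s , x , refl , fx = a ∷ s , x , refl , fx

isInfixᵇ : Word → Word → Bool
isInfixᵇ u = anySuffixᵇ (isPrefixᵇ u)

isInfixᵇ-sound : ∀ u v → T (isInfixᵇ u v) → Infix u v
isInfixᵇ-sound u v inf with anySuffixᵇ-sound (isPrefixᵇ u) v inf
... | s , x , refl , pre with isPrefixᵇ-sound u x pre
...   | t , refl = s , t , refl

anyPositiveᵇ : (ℕ → Bool) → ℕ → Bool
anyPositiveᵇ f zero = false
anyPositiveᵇ f (suc n) = f (suc n) ∨ anyPositiveᵇ f n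

anyPositiveᵇ-sound : ∀ f n → T (anyPositiveᵇ f n) → ∃ λ q → 0 < q × T (f q)
anyPositiveᵇ-sound f (suc n) any with Equivalence.to T-∨ any
... | inj₁ fq = suc n , s≤s z≤n , fq
... | inj₂ any′ = anyPositiveᵇ-sound f n any′

highPowerᵇ : Word → Bool
highPowerᵇ x = anyPositiveᵇ (λ q → (11 * q ≤ᵇ 3 * length x) ∧ isPeriodᵇ x q) (length x)

complementedQuadrupleᵇ : Word → Word → Bool
complementedQuadrupleᵇ v (a ∷ b ∷ c ∷ d ∷ _) = isInfixᵇ (compl (a ∷ b ∷ c ∷ d ∷ [])) v
complementedQuadrupleᵇ v _ = false

forbiddenᵇ : Word → Bool
forbiddenᵇ v = anySuffixᵇ (λ x → highPowerᵇ x ∨ complementedQuadrupleᵇ v x) v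

Pattern : Set
Pattern = List (Maybe Bool)

Matches : Word → Pattern → Set
Matches [] [] = ⊤
Matches (a ∷ t) (nothing ∷ ps) = Matches t ps
Matches (a ∷ t) (just b ∷ ps) = a ≡ b × Matches t ps
Matches _ _ = ⊥

allForbiddenᵇ : Word → Pattern → Bool
allForbiddenᵇ v [] = forbiddenᵇ v
allForbiddenᵇ v (nothing ∷ ps) = forbiddenᵇ v ∨ (allForbiddenᵇ (v ++ [ false ]) ps ∧ allForbiddenᵇ (v ++ [ true ]) ps)
allForbiddenᵇ v (just b ∷ ps) = forbiddenᵇ v ∨ allForbiddenᵇ (v ++ [ b ]) ps

matches-self : ∀ v → Matches v (map just v)
matches-self [] = _
matches-self (a ∷ v) = refl , matches-self v

FitsAt : BiWord → ℤ → ℕ → Pattern → Set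
FitsAt w j k [] = ⊤
FitsAt w j k (nothing ∷ ps) = FitsAt w j (suc k) ps
FitsAt w j k (just b ∷ ps) = w (j ⊕ k) ≡ b × FitsAt w j (suc k) ps

matches-windowZ : ∀ w j k ps → FitsAt w j k ps → Matches (windowZ w (j ⊕ k) (length ps)) ps
matches-windowZ w j k [] _ = _
matches-windowZ w j k (nothing ∷ ps) fits =
  subst (λ i → Matches (windowZ w i (length ps)) ps) (sym (⊕-suc j k)) (matches-windowZ w j (suc k) ps fits)
matches-windowZ w j k (just b ∷ ps) (wjk≡b , fits) =
  wjk≡b , subst (λ i → Matches (windowZ w i (length ps)) ps) (sym (⊕-suc j k)) (matches-windowZ w j (suc k) ps fits)

module _ {w : BiWord} (free : ElevenThirdsFree w) (noPairs : NoComplementaryPairs4 w) where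

  forbiddenᵇ-sound : ∀ v → T (forbiddenᵇ v) → ¬ FactorZ w v
  forbiddenᵇ-sound v forb fv with anySuffixᵇ-sound _ v forb
  ... | s , x , refl , bad with Equivalence.to T-∨ bad
  ...   | inj₁ power with anyPositiveᵇ-sound _ (length x) power
  ...     | q , q>0 , short×per with Equivalence.to T-∧ short×per
  ...       | short , per = <⇒≱ (period-bound free fx (isPeriodᵇ-sound x q>0 per)) (≤ᵇ⇒≤ (11 * q) (3 * length x) short)
    where
    fx : FactorZ w x
    fx = factorZ-++ʳ s fv
  forbiddenᵇ-sound v forb fv | s , a ∷ b ∷ c ∷ d ∷ r , refl , bad | inj₂ inf =
    noPairs (a ∷ b ∷ c ∷ d ∷ []) refl
      (factorZ-++ˡ (factorZ-++ʳ s fv))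
      (factorZ-infix fv (isInfixᵇ-sound _ v inf))

  allForbiddenᵇ-sound : ∀ v ps → T (allForbiddenᵇ v ps) → ∀ t → Matches t ps → ¬ FactorZ w (v ++ t)
  allForbiddenᵇ-sound v [] forb [] _ fv = forbiddenᵇ-sound v forb (factorZ-++ˡ fv)
  allForbiddenᵇ-sound v (nothing ∷ ps) forb (a ∷ t) m fvt with Equivalence.to T-∨ forb
  ... | inj₁ forbv = forbiddenᵇ-sound v forbv (factorZ-++ˡ fvt)
  ... | inj₂ both = allForbiddenᵇ-sound (v ++ [ a ]) ps (pick {λ a → T (allForbiddenᵇ (v ++ [ a ]) ps)} a (Equivalence.to T-∧ both)) t m
                      (subst (FactorZ w) (sym (++-assoc v [ a ] t)) fvt)
    where
    pick : ∀ {X : Bool → Set} a → X false × X true → X a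
    pick false (x , _) = x
    pick true (_ , x) = x
  allForbiddenᵇ-sound v (just b ∷ ps) forb (a ∷ t) (refl , m) fvt with Equivalence.to T-∨ forb
  ... | inj₁ forbv = forbiddenᵇ-sound v forbv (factorZ-++ˡ fvt)
  ... | inj₂ next = allForbiddenᵇ-sound (v ++ [ a ]) ps next t m (subst (FactorZ w) (sym (++-assoc v [ a ] t)) fvt)

  word-forbidden : ∀ v → allForbiddenᵇ [] (map just v) ≡ true → ¬ FactorZ w v
  word-forbidden v forb = allForbiddenᵇ-sound [] (map just v) (Equivalence.from T-≡ forb) v (matches-self v)

  pattern-forbidden : ∀ ps → allForbiddenᵇ [] ps ≡ true → ∀ j → ¬ FitsAt w j 0 ps
  pattern-forbidden ps forb j fits =
    allForbiddenᵇ-sound [] ps (Equivalence.from T-≡ forb) _ (matches-windowZ w j 0 ps fits) (factorZ-window w (j ⊕ 0) (length ps))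

DoubleAt : BiWord → Bool → ℤ → Set
DoubleAt w a i = w i ≡ a × w (i ⊕ 1) ≡ a

gapPattern : ℕ → Pattern
gapPattern m = replicate 12 nothing ++ just false ∷ just false ∷ replicate m nothing ++ just true ∷ just true ∷ replicate 12 nothing

-- Stated with ≡ and proved by refl: Agda decides these instances far faster than the T-form.
gapPattern-forbidden : ∀ m → m ≤ 5 → allForbiddenᵇ [] (gapPattern m) ≡ true
gapPattern-forbidden 0 _ = refl
gapPattern-forbidden 1 _ = refl
gapPattern-forbidden 2 _ = refl
gapPattern-forbidden 3 _ = refl
gapPattern-forbidden 4 _ = refl
gapPattern-forbidden 5 _ = refl
gapPattern-forbidden (suc (suc (suc (suc (suc (suc _)))))) (s≤s (s≤s (s≤s (s≤s (s≤s ())))))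

fitsAt-gap : ∀ {w j k} m ps → FitsAt w j (m + k) ps → FitsAt w j k (replicate m nothing ++ ps)
fitsAt-gap zero ps fits = fits
fitsAt-gap {w} {j} {k} (suc m) ps fits = fitsAt-gap m ps (subst (λ n → FitsAt w j n ps) (sym (+-suc m k)) fits)

gapPattern-fits : ∀ {w} m p → DoubleAt w false p → DoubleAt w true (p ⊕ (2 + m)) → FitsAt w (p ⊖ 12) 0 (gapPattern m)
gapPattern-fits {w} m p (w₀ , w₁) (w₂ , w₃) =
  at 0 refl (trans (cong w (⊕-identityʳ p)) w₀) ,
  at 1 refl w₁ ,
  fitsAt-gap m _ (at (2 + m) (+-comm m 14) w₂ , at (3 + m) (cong suc (+-comm m 14)) (trans (cong w (sym (⊕-suc p (2 + m)))) w₃) , _)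
  where
  at : ∀ {b} k {n} → n ≡ 12 + k → w (p ⊕ k) ≡ b → w (p ⊖ 12 ⊕ n) ≡ b
  at k refl wk = trans (cong w (⊖-⊕-+ p 12 k)) wk

module _ {w : BiWord} (free : ElevenThirdsFree w) where

  double-within-7 : ∀ i → ∃₂ λ k a → k < 7 × DoubleAt w a (i ⊕ k)
  double-within-7 i with least-below (λ k → w (i ⊕ k) Bool.≟ w (i ⊕ suc k)) 7
  ... | inj₁ (k , k<7 , eq , _) = k , w (i ⊕ k) , k<7 , refl , trans (cong w (⊕-suc i k)) (sym eq)
  ... | inj₂ alternating = contradiction (period-bound free (factorZ-window w i 8) (s≤s z≤n , period2)) 24≮22
    where
    24≮22 : ¬ (24 < 22)
    24≮22 24<22 = <⇒≱ 24<22 (m≤m+n 22 2)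
    period2 : ∀ j → j + 2 < 8 → nth (windowZ w i 8) j ≡ nth (windowZ w i 8) (j + 2)
    period2 j j+2<8 = begin
      nth (windowZ w i 8) j       ≡⟨ nth-windowZ w i (<-trans (n<1+n j) (<-trans (n<1+n (suc j)) 2+j<8)) ⟩
      just (w (i ⊕ j))            ≡⟨ cong just (¬-not (alternating j (<-trans (n<1+n j) 1+j<7))) ⟩
      just (not (w (i ⊕ suc j)))  ≡⟨ cong (just ∘ not) (¬-not (alternating (suc j) 1+j<7)) ⟩
      just (not (not (w (i ⊕ suc (suc j))))) ≡⟨ cong just (not-involutive _) ⟩
      just (w (i ⊕ (2 + j)))      ≡⟨ nth-windowZ w i 2+j<8 ⟨
      nth (windowZ w i 8) (2 + j) ≡⟨ cong (nth (windowZ w i 8)) (+-comm 2 j) ⟩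
      nth (windowZ w i 8) (j + 2) ∎
      where
      open ≡-Reasoning
      2+j<8 : 2 + j < 8
      2+j<8 = subst (_< 8) (+-comm j 2) j+2<8
      1+j<7 : suc j < 7
      1+j<7 = s<s⁻¹ 2+j<8

module _ {w : BiWord} (free : ElevenThirdsFree w) (noPairs : NoComplementaryPairs4 w) where

  no-00-before-11 : ∀ d p → DoubleAt w false p → DoubleAt w true (p ⊕ d) → ⊥
  no-00-before-11 = <-rec _ step
    where
    step : ∀ d → (∀ {d′} → d′ < d → ∀ p → DoubleAt w false p → DoubleAt w true (p ⊕ d′) → ⊥) →
           ∀ p → DoubleAt w false p → DoubleAt w true (p ⊕ d) → ⊥
    step zero _ p (w₀ , _) (w₀′ , _) = contradiction (trans (sym w₀) (trans (cong w (sym (⊕-identityʳ p))) w₀′)) λ ()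
    step 1 _ p (_ , w₁) (w₁′ , _) = contradiction (trans (sym w₁) w₁′) λ ()
    step (suc (suc m)) closer p zeros ones with m ≤? 5
    ... | yes m≤5 = pattern-forbidden free noPairs (gapPattern m) (gapPattern-forbidden m m≤5) (p ⊖ 12) (gapPattern-fits m p zeros ones)
    ... | no m≰5 with double-within-7 free (p ⊕ 1) -- a 00 or 11 strictly between the two
    ...   | k , true , k<7 , ones′ = closer (s≤s k<1+m) p zeros (subst (DoubleAt w true) (⊕-assoc p 1 k) ones′)
      where
      k<1+m : k < suc m
      k<1+m = <-≤-trans k<7 (s≤s (≰⇒> m≰5))
    ...   | k , false , k<7 , zeros′ =
      closer (s≤s (m∸n≤m (suc m) k)) (p ⊕ suc k) (subst (DoubleAt w false) (⊕-assoc p 1 k) zeros′)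
        (subst (DoubleAt w true) (sym (trans (⊕-assoc p (suc k) (suc m ∸ k)) (cong (λ n → p ⊕ suc n) (m+[n∸m]≡n k≤1+m)))) ones)
      where
      k≤1+m : k ≤ suc m
      k≤1+m = <⇒≤ (<-≤-trans k<7 (s≤s (≰⇒> m≰5)))

doubleAt-compl : ∀ {w a i} → DoubleAt w a i → DoubleAt (complZ w) (not a) i
doubleAt-compl (wᵢ , wᵢ₊₁) = cong not wᵢ , cong not wᵢ₊₁

module _ {w : BiWord} (free : ElevenThirdsFree w) (noPairs : NoComplementaryPairs4 w) where

  zeros⇒no-ones : ∀ {p} → DoubleAt w false p → ∀ q → ¬ DoubleAt w true q
  zeros⇒no-ones {p} zeros q ones with ⊕-total p q
  ... | inj₁ (d , refl) = no-00-before-11 free noPairs d p zeros ones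
  ... | inj₂ (d , refl) = no-00-before-11 (elevenThirdsFree-compl free) (noComplementaryPairs4-compl noPairs)
                            d q (doubleAt-compl {w} ones) (doubleAt-compl {w} zeros)

Φ : ℕ → Word → Word
Φ zero v = v
Φ (suc n) v = Φ n (φ v)

Φ-φ : ∀ n v → Φ n (φ v) ≡ φ (Φ n v)
Φ-φ zero v = refl
Φ-φ (suc n) v = Φ-φ n (φ v)

φ^≡Φ : ∀ n → φ^ n ≡ Φ n [ false ]
φ^≡Φ zero = refl
φ^≡Φ (suc n) = trans (cong φ (φ^≡Φ n)) (sym (Φ-φ n [ false ]))

Φ-+ : ∀ m n v → Φ (m + n) v ≡ Φ n (Φ m v)
Φ-+ zero n v = refl
Φ-+ (suc m) n v = Φ-+ m n (φ v)

Φ-++ : ∀ n u v → Φ n (u ++ v) ≡ Φ n u ++ Φ n v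
Φ-++ zero u v = refl
Φ-++ (suc n) u v = trans (cong (Φ n) (concatMap-++ φ-letter u v)) (Φ-++ n (φ u) (φ v))

H : ℕ → Word → Word
H n v = h (Φ n v)

H-++ : ∀ n u v → H n (u ++ v) ≡ H n u ++ H n v
H-++ n u v = trans (cong h (Φ-++ n u v)) (concatMap-++ h-letter (Φ n u) (Φ n v))

H-[] : ∀ n → H n [] ≡ []
H-[] zero = refl
H-[] (suc n) = H-[] n

infix-H : ∀ n {u v} → Infix u v → Infix (H n u) (H n v)
infix-H n {u} (s , t , refl) = H n s , H n t , trans (H-++ n s (u ++ t)) (cong (H n s ++_) (H-++ n u t))

block : ℕ → Bool → Word
block n a = H n [ a ]

H-∷ : ∀ n a v → H n (a ∷ v) ≡ block n a ++ H n v
H-∷ n a v = H-++ n [ a ] v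

block-suc-false : ∀ n → block (suc n) false ≡ block n false ++ block n true
block-suc-false n = trans (H-∷ n false [ true ]) (cong (block n false ++_) (trans (H-∷ n true []) (trans (cong (block n true ++_) (H-[] n)) (++-identityʳ _))))

∣block∣ : ℕ → Bool → ℕ
∣block∣ n a = length (block n a)

∣block∣-suc-false : ∀ n → ∣block∣ (suc n) false ≡ ∣block∣ n false + ∣block∣ n true
∣block∣-suc-false n = trans (cong length (block-suc-false n)) (length-++ (block n false))

∣block∣-positive : ∀ n a → 0 < ∣block∣ n a
∣block∣-positive zero false = s≤s z≤n
∣block∣-positive zero true = s≤s z≤n
∣block∣-positive (suc n) false = subst (0 <_) (sym (∣block∣-suc-false n)) (<-≤-trans (∣block∣-positive n false) (m≤m+n _ _))
∣block∣-positive (suc n) true = ∣block∣-positive n false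

∣block∣-grows : ∀ n → n ≤ ∣block∣ n true × n < ∣block∣ n false
∣block∣-grows zero = z≤n , s≤s z≤n
∣block∣-grows (suc n) with ∣block∣-grows n
... | _ , n<∣b₀∣ = n<∣b₀∣ , subst (suc n <_) (sym (∣block∣-suc-false n))
                              (subst (_≤ ∣block∣ n false + ∣block∣ n true) (+-comm (suc n) 1) (+-mono-≤ n<∣b₀∣ (∣block∣-positive n true)))

block-prefix : ∀ n a → ∃ λ s → block (suc n) a ≡ block n false ++ s
block-prefix n false = block n true , block-suc-false n
block-prefix n true = [] , sym (++-identityʳ _)

block-conjugate : ∀ n → block (suc n) false ++ block (2 + n) false ≡ block (2 + n) false ++ block n true ++ block n false
block-conjugate n = begin
  X ++ block (2 + n) false ≡⟨ cong (X ++_) (block-suc-false (suc n)) ⟩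
  X ++ (X ++ Y)          ≡⟨ cong (λ u → X ++ (u ++ Y)) (block-suc-false n) ⟩
  X ++ ((Y ++ Z) ++ Y)   ≡⟨ cong (X ++_) (++-assoc Y Z Y) ⟩
  X ++ (Y ++ (Z ++ Y))   ≡⟨ ++-assoc X Y (Z ++ Y) ⟨
  (X ++ Y) ++ (Z ++ Y)   ≡⟨ cong (_++ (Z ++ Y)) (block-suc-false (suc n)) ⟨
  block (2 + n) false ++ Z ++ Y ∎
  where
  open ≡-Reasoning
  X Y Z : Word
  X = block (suc n) false
  Y = block n false
  Z = block n true

H-pair-starts-with-square : ∀ k a b → ∃ λ r → H (3 + k) (a ∷ b ∷ []) ≡ block (2 + k) false ++ block (2 + k) false ++ r
H-pair-starts-with-square k a b with block-prefix (2 + k) b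
... | s , bₛ = pair a , trans (H-∷ (3 + k) a [ b ]) (trans (cong (block (3 + k) a ++_) bₛ) (square a))
  where
  K X : Word
  K = block (2 + k) false
  X = block (1 + k) false
  pair : Bool → Word
  pair true = s
  pair false = (block k true ++ block k false) ++ s
  square : ∀ a → block (3 + k) a ++ K ++ s ≡ K ++ K ++ pair a
  square true = refl
  square false = begin
    block (3 + k) false ++ K ++ s ≡⟨ cong (_++ K ++ s) (block-suc-false (2 + k)) ⟩
    (K ++ X) ++ K ++ s   ≡⟨ ++-assoc K X (K ++ s) ⟩
    K ++ X ++ K ++ s     ≡⟨ cong (K ++_) (++-assoc X K s) ⟨
    K ++ (X ++ K) ++ s   ≡⟨ cong (λ u → K ++ u ++ s) (block-conjugate k) ⟩
    K ++ (K ++ block k true ++ block k false) ++ s ≡⟨ cong (K ++_) (++-assoc K _ s) ⟩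
    K ++ K ++ (block k true ++ block k false) ++ s ∎
    where open ≡-Reasoning

H-11-fourth-power : ∀ k a b → let K = block (2 + k) false in
  ∃ λ r → H (3 + k) (true ∷ true ∷ a ∷ b ∷ []) ≡ K ++ K ++ K ++ K ++ r
H-11-fourth-power k a b with H-pair-starts-with-square k a b
... | r , eq = r , trans (H-∷ (3 + k) true (true ∷ a ∷ b ∷ []))
                     (cong (block (2 + k) false ++_) (trans (H-∷ (3 + k) true (a ∷ b ∷ [])) (cong (block (2 + k) false ++_) eq)))

module _ {w : BiWord} (free : ElevenThirdsFree w) (noPairs : NoComplementaryPairs4 w) where

  H-11-forbidden : ∀ n a b → ¬ FactorZ w (H n (true ∷ true ∷ a ∷ b ∷ []))
  H-11-forbidden 0 false false = word-forbidden free noPairs _ refl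
  H-11-forbidden 0 false true = word-forbidden free noPairs _ refl
  H-11-forbidden 0 true false = word-forbidden free noPairs _ refl
  H-11-forbidden 0 true true = word-forbidden free noPairs _ refl
  H-11-forbidden 1 false false = word-forbidden free noPairs _ refl
  H-11-forbidden 1 false true = word-forbidden free noPairs _ refl
  H-11-forbidden 1 true false = word-forbidden free noPairs _ refl
  H-11-forbidden 1 true true = word-forbidden free noPairs _ refl
  H-11-forbidden 2 false false = word-forbidden free noPairs _ refl
  H-11-forbidden 2 false true = word-forbidden free noPairs _ refl
  H-11-forbidden 2 true false = word-forbidden free noPairs _ refl
  H-11-forbidden 2 true true = word-forbidden free noPairs _ refl
  H-11-forbidden (suc (suc (suc k))) a b f with H-11-fourth-power k a b
  ... | r , eq = fourth-power-forbidden free (block (2 + k) false) r (∣block∣-positive (2 + k) false) (subst (FactorZ w) eq f)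

nth-fromMaybe : ∀ b v {k} → k < length v → just (fromMaybe b (nth v k)) ≡ nth v k
nth-fromMaybe b (a ∷ v) {zero} _ = refl
nth-fromMaybe b (a ∷ v) {suc k} (s≤s k<n) = nth-fromMaybe b v k<n

block-extends : ∀ n d → ∃ λ t → block (d + n) false ≡ block n false ++ t
block-extends n zero = [] , sym (++-identityʳ _)
block-extends n (suc d) with block-extends n d
... | t , eq = t ++ block (d + n) true ,
  trans (block-suc-false (d + n)) (trans (cong (_++ block (d + n) true) eq) (++-assoc (block n false) t _))

nth-block-extends : ∀ n d {k} → k < ∣block∣ n false → nth (block (d + n) false) k ≡ nth (block n false) k
nth-block-extends n d k<n with block-extends n d
... | t , eq = trans (cong (λ v → nth v _) eq) (nth-++ˡ (block n false) t k<n)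

nth-block-hfib : ∀ M {k} → k < ∣block∣ M false → nth (block M false) k ≡ just (hfib k)
nth-block-hfib M {k} k<n = begin
  nth (block M false) k        ≡⟨ nth-block-extends M k k<n ⟨
  nth (block (k + M) false) k  ≡⟨ cong (λ n → nth (block n false) k) (+-comm k M) ⟩
  nth (block (M + k) false) k  ≡⟨ nth-block-extends k M (proj₂ (∣block∣-grows k)) ⟩
  nth (block k false) k        ≡⟨ nth-fromMaybe false (block k false) (proj₂ (∣block∣-grows k)) ⟨
  just (fromMaybe false (nth (block k false) k)) ≡⟨ cong (λ v → just (fromMaybe false (nth (h v) k))) (φ^≡Φ k) ⟨
  just (hfib k)                ∎
  where open ≡-Reasoning

windowN-hfib : ∀ M → windowN hfib 0 (∣block∣ M false) ≡ block M false
windowN-hfib M = windowN-nth hfib 0 (block M false) λ j j<n → nth-block-hfib M j<n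

infix-block⇒factorN : ∀ {u} M → Infix u (block M false) → FactorN hfib u
infix-block⇒factorN M = windowN-prefix-infix hfib (windowN-hfib M)

factorN⇒infix-block : ∀ {u} → FactorN hfib u → ∃ λ M → Infix u (block M false)
factorN⇒infix-block {u} (i , occ) = M , subst₂ Infix occ (trans (cong (windowN hfib 0) ∣V∣≡) (windowN-hfib M)) (windowN-infix hfib 0 i (length u) _)
  where
  M : ℕ
  M = i + length u
  ∣V∣≡ : i + length u + (∣block∣ M false ∸ M) ≡ ∣block∣ M false
  ∣V∣≡ = m+[n∸m]≡n (<⇒≤ (proj₂ (∣block∣-grows M)))

pair-infix : ∀ a c → (a ≡ true → c ≡ false) → Infix (a ∷ c ∷ []) (Φ 4 [ false ])
pair-infix false false _ = false ∷ true ∷ [] , true ∷ false ∷ true ∷ false ∷ [] , refl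
pair-infix false true _ = [] , false ∷ false ∷ true ∷ false ∷ true ∷ false ∷ [] , refl
pair-infix true false _ = [ false ] , false ∷ true ∷ false ∷ true ∷ false ∷ [] , refl
pair-infix true true 1→0 = contradiction (1→0 refl) λ ()

-- At level N, w is cut into blocks block N a: IsStart N p says that a block begins at p, and
-- letterAt N p is its letter. Since block (N+1) 0 = block N 0 ++ block N 1 and block (N+1) 1 =
-- block N 0, a level-(N+1) block begins with a level-N 0-block and is a 0-block exactly when a
-- level-N 1-block follows.
module Parsing {w : BiWord} (free : ElevenThirdsFree w) (noPairs : NoComplementaryPairs4 w)
               (noOnes : ∀ q → ¬ DoubleAt w true q) where

  letterAt : ℕ → ℤ → Bool
  letterAt zero p = w (p ⊕ 1)
  letterAt (suc N) p = not (letterAt N (p ⊕ ∣block∣ N false))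

  IsStart : ℕ → ℤ → Set
  IsStart zero p = w p ≡ false
  IsStart (suc N) p = IsStart N p × letterAt N p ≡ false

  next : ℕ → ℤ → ℤ
  next N p = p ⊕ ∣block∣ N (letterAt N p)

  lettersFrom : ℕ → ℕ → ℤ → Word
  lettersFrom N zero p = []
  lettersFrom N (suc k) p = letterAt N p ∷ lettersFrom N k (next N p)

  record Parses (N : ℕ) : Set where
    field
      occurs : ∀ {p} → IsStart N p → OccursAt w p (block N (letterAt N p))
      next-isStart : ∀ {p} → IsStart N p → IsStart N (next N p)
      previous : ∀ {p} → IsStart N p → ∃ λ q → IsStart N q × next N q ≡ p
      covers : ∀ i → ∃₂ λ p d → IsStart N p × d < ∣block∣ N (letterAt N p) × p ⊕ d ≡ i

    occurs-H : ∀ k {p} → IsStart N p → OccursAt w p (H N (lettersFrom N k p))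
    occurs-H zero {p} _ = subst (OccursAt w p) (sym (H-[] N)) refl
    occurs-H (suc k) {p} start = subst (OccursAt w p) (sym (H-∷ N (letterAt N p) (lettersFrom N k (next N p))))
      (occursAt-++ (block N (letterAt N p)) (occurs start) (occurs-H k (next-isStart start)))

    no-11 : ∀ {p} → IsStart N p → letterAt N p ≡ true → letterAt N (next N p) ≡ false
    no-11 {p} start one with letterAt N (next N p) in one′
    ... | false = refl
    ... | true = ⊥-elim (H-11-forbidden free noPairs N _ _ (p , subst (λ v → OccursAt w p (H N v)) letters (occurs-H 4 start)))
      where
      letters : lettersFrom N 4 p ≡ true ∷ true ∷ lettersFrom N 2 (next N (next N p))
      letters = cong₂ (λ a b → a ∷ b ∷ lettersFrom N 2 (next N (next N p))) one one′

  one-then-zero : ∀ q → w q ≡ true → w (q ⊕ 1) ≡ false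
  one-then-zero q wq with w (q ⊕ 1) in e
  ... | false = refl
  ... | true = ⊥-elim (noOnes q (wq , e))

  zero-before-one : ∀ q → w (q ⊕ 1) ≡ true → w q ≡ false
  zero-before-one q wq₁ with w q in e
  ... | false = refl
  ... | true = ⊥-elim (noOnes q (e , wq₁))

  parses-zero : Parses 0
  parses-zero = record { occurs = occurs₀ ; next-isStart = next₀ ; previous = previous₀ ; covers = covers₀ }
    where
    occurs₀ : ∀ {p} → w p ≡ false → OccursAt w p (block 0 (w (p ⊕ 1)))
    occurs₀ {p} wp with w (p ⊕ 1) in e
    ... | false = cong [_] wp
    ... | true = cong₂ (λ a b → a ∷ b ∷ []) wp e

    next₀ : ∀ {p} → w p ≡ false → w (next 0 p) ≡ false
    next₀ {p} wp with w (p ⊕ 1) in e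
    ... | false = e
    ... | true = trans (cong w (sym (⊕-assoc p 1 1))) (one-then-zero (p ⊕ 1) e)

    previous₀ : ∀ {p} → w p ≡ false → ∃ λ q → w q ≡ false × next 0 q ≡ p
    previous₀ {p} wp with w (p ⊖ 1) in e
    ... | false = p ⊖ 1 , e , trans (cong (λ a → p ⊖ 1 ⊕ ∣block∣ 0 a) (trans (cong w (⊖-⊕-inverse p 1)) wp)) (⊖-⊕-inverse p 1)
    ... | true = q , zero-before-one q wq₁ , (begin
      q ⊕ ∣block∣ 0 (w (q ⊕ 1)) ≡⟨ cong (λ a → q ⊕ ∣block∣ 0 a) wq₁ ⟩
      q ⊕ 2                     ≡⟨ ⊕-assoc q 1 1 ⟨
      q ⊕ 1 ⊕ 1                 ≡⟨ cong (_⊕ 1) (⊖-⊕-inverse (p ⊖ 1) 1) ⟩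
      p ⊖ 1 ⊕ 1                 ≡⟨ ⊖-⊕-inverse p 1 ⟩
      p                         ∎)
      where
      open ≡-Reasoning
      q : ℤ
      q = p ⊖ 1 ⊖ 1
      wq₁ : w (q ⊕ 1) ≡ true
      wq₁ = trans (cong w (⊖-⊕-inverse (p ⊖ 1) 1)) e

    covers₀ : ∀ i → ∃₂ λ p d → w p ≡ false × d < ∣block∣ 0 (w (p ⊕ 1)) × p ⊕ d ≡ i
    covers₀ i with w i in e
    ... | false = i , 0 , e , ∣block∣-positive 0 (w (i ⊕ 1)) , ⊕-identityʳ i
    ... | true = i ⊖ 1 , 1 , zero-before-one (i ⊖ 1) wᵢ , subst (λ a → 1 < ∣block∣ 0 a) (sym wᵢ) (s≤s (s≤s z≤n)) , ⊖-⊕-inverse i 1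
      where
      wᵢ : w (i ⊖ 1 ⊕ 1) ≡ true
      wᵢ = trans (cong w (⊖-⊕-inverse i 1)) e

  parses-suc : ∀ {N} → Parses N → Parses (suc N)
  parses-suc {N} parsesN = record { occurs = occurs′ ; next-isStart = next′ ; previous = previous′ ; covers = covers′ }
    where
    open Parses parsesN

    next-zero : ∀ {p} → letterAt N p ≡ false → next N p ≡ p ⊕ ∣block∣ N false
    next-zero {p} z = cong (λ a → p ⊕ ∣block∣ N a) z

    second : ∀ {p} → IsStart (suc N) p → IsStart N (p ⊕ ∣block∣ N false)
    second (start , z) = subst (IsStart N) (next-zero z) (next-isStart start)

    before-one : ∀ {q} → IsStart N q → letterAt N q ≡ true →
      ∃ λ r → IsStart (suc N) r × letterAt (suc N) r ≡ false × r ⊕ ∣block∣ N false ≡ q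
    before-one {q} start one with previous start
    ... | r , start-r , r→q with letterAt N r in e
    ...   | false = r , (start-r , e) , cong not (trans (cong (letterAt N) r→q) one) , r→q
    ...   | true = contradiction (trans (sym one) (trans (cong (letterAt N) (sym r→q′)) (no-11 start-r e))) λ ()
      where
      r→q′ : next N r ≡ q
      r→q′ = trans (cong (λ a → r ⊕ ∣block∣ N a) e) r→q

    occurs′ : ∀ {p} → IsStart (suc N) p → OccursAt w p (block (suc N) (letterAt (suc N) p))
    occurs′ {p} s@(start , z) with letterAt N (p ⊕ ∣block∣ N false) in e
    ... | true = subst (OccursAt w p) (sym (block-suc-false N))
                   (occursAt-++ (block N false) (subst (λ a → OccursAt w p (block N a)) z (occurs start))
                                                (subst (λ a → OccursAt w (p ⊕ ∣block∣ N false) (block N a)) e (occurs (second s))))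
    ... | false = subst (λ a → OccursAt w p (block N a)) z (occurs start)

    next′ : ∀ {p} → IsStart (suc N) p → IsStart (suc N) (next (suc N) p)
    next′ {p} s@(start , z) with letterAt N (p ⊕ ∣block∣ N false) in e
    ... | true = subst (IsStart (suc N)) (sym position) (next-isStart (second s) , no-11 (second s) e)
      where
      position : p ⊕ ∣block∣ (suc N) false ≡ next N (p ⊕ ∣block∣ N false)
      position = begin
        p ⊕ ∣block∣ (suc N) false                 ≡⟨ cong (p ⊕_) (∣block∣-suc-false N) ⟩
        p ⊕ (∣block∣ N false + ∣block∣ N true)    ≡⟨ ⊕-assoc p _ _ ⟨
        p ⊕ ∣block∣ N false ⊕ ∣block∣ N true      ≡⟨ cong (λ a → p ⊕ ∣block∣ N false ⊕ ∣block∣ N a) e ⟨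
        next N (p ⊕ ∣block∣ N false)              ∎
        where open ≡-Reasoning
    ... | false = second s , e

    previous′ : ∀ {p} → IsStart (suc N) p → ∃ λ q → IsStart (suc N) q × next (suc N) q ≡ p
    previous′ {p} (start , z) with previous start
    ... | q , start-q , q→p with letterAt N q in e
    ...   | false = q , (start-q , e) , trans (cong (λ a → q ⊕ ∣block∣ (suc N) (not (letterAt N a))) q→p)
                                           (trans (cong (λ a → q ⊕ ∣block∣ (suc N) (not a)) z) q→p)
    ...   | true with before-one start-q e
    ...     | r , start-r , zero-r , r⊕ℓ₀≡q = r , start-r , (begin
      r ⊕ ∣block∣ (suc N) (letterAt (suc N) r)  ≡⟨ cong (λ a → r ⊕ ∣block∣ (suc N) a) zero-r ⟩
      r ⊕ ∣block∣ (suc N) false                 ≡⟨ cong (r ⊕_) (∣block∣-suc-false N) ⟩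
      r ⊕ (∣block∣ N false + ∣block∣ N true)    ≡⟨ ⊕-assoc r _ _ ⟨
      r ⊕ ∣block∣ N false ⊕ ∣block∣ N true      ≡⟨ cong (_⊕ ∣block∣ N true) r⊕ℓ₀≡q ⟩
      q ⊕ ∣block∣ N true                        ≡⟨ q→p ⟩
      p                                         ∎)
      where open ≡-Reasoning

    ℓ₀≤∣block∣ : ∀ a → ∣block∣ N false ≤ ∣block∣ (suc N) a
    ℓ₀≤∣block∣ true = ≤-refl
    ℓ₀≤∣block∣ false = subst (∣block∣ N false ≤_) (sym (∣block∣-suc-false N)) (m≤m+n _ _)

    covers′ : ∀ i → ∃₂ λ p d → IsStart (suc N) p × d < ∣block∣ (suc N) (letterAt (suc N) p) × p ⊕ d ≡ i
    covers′ i with covers i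
    ... | p , d , start , d<ℓ , p⊕d≡i with letterAt N p in e
    ...   | false = p , d , (start , e) , <-≤-trans d<ℓ (ℓ₀≤∣block∣ _) , p⊕d≡i
    ...   | true with before-one start e
    ...     | r , start-r , zero-r , r⊕ℓ₀≡p =
      r , ∣block∣ N false + d , start-r ,
      subst (λ a → ∣block∣ N false + d < ∣block∣ (suc N) a) (sym zero-r)
        (subst (∣block∣ N false + d <_) (sym (∣block∣-suc-false N)) (+-monoʳ-< (∣block∣ N false) d<ℓ)) ,
      trans (sym (⊕-assoc r _ d)) (trans (cong (_⊕ d) r⊕ℓ₀≡p) p⊕d≡i)

  parses : ∀ N → Parses N
  parses zero = parses-zero
  parses (suc N) = parses-suc (parses N)

  infix-block⇒factorZ : ∀ {u} M → Infix u (block M false) → FactorZ w u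
  infix-block⇒factorZ M inf with Parses.covers (parses (suc M)) ℤ.0ℤ
  ... | p , _ , (start , letter₀) , _ =
    factorZ-infix (p , subst (λ a → OccursAt w p (block M a)) letter₀ (Parses.occurs (parses M) start)) inf

  factorZ⇒infix-block : ∀ {u} → FactorZ w u → ∃ λ M → Infix u (block M false)
  factorZ⇒infix-block {u} (i , occ) with Parses.covers (parses (length u)) i
  ... | p , d , start , d<∣a∣ , p⊕d≡i = 4 + L , infix-trans u⊑V V⊑block
    where
    L : ℕ
    L = length u
    open Parses (parses L)
    a c : Bool
    a = letterAt L p
    c = letterAt L (next L p)
    V : Word
    V = H L (a ∷ c ∷ [])
    L≤∣c∣ : L ≤ ∣block∣ L c
    L≤∣c∣ with c
    ... | true = proj₁ (∣block∣-grows L)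
    ... | false = <⇒≤ (proj₂ (∣block∣-grows L))
    d+L≤∣V∣ : d + L ≤ length V
    d+L≤∣V∣ = subst (d + L ≤_) (sym (trans (cong length (H-∷ L a [ c ])) (length-++ (block L a)))) (+-mono-≤ (<⇒≤ d<∣a∣) L≤∣c∣)
    u⊑V : Infix u V
    u⊑V = subst₂ Infix (trans (cong (λ j → windowZ w j L) p⊕d≡i) occ)
                       (trans (cong (windowZ w p) (m+[n∸m]≡n d+L≤∣V∣)) (occurs-H 2 start))
                       (windowZ-infix w p d L _)
    V⊑block : Infix V (block (4 + L) false)
    V⊑block = subst (Infix V) (cong h (sym (Φ-+ 4 L [ false ]))) (infix-H L (pair-infix a c (no-11 start)))

  sameFactors : SameFactors w hfib
  sameFactors u = mk⇔ (uncurry infix-block⇒factorN ∘ factorZ⇒infix-block)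
                      (uncurry infix-block⇒factorZ ∘ factorN⇒infix-block)

theorem16 : (w : BiWord) → ElevenThirdsFree w → NoComplementaryPairs4 w →
    SameFactors w hfib ⊎ SameFactors w (complInf hfib)
theorem16 w free noPairs with double-within-7 free ℤ.0ℤ
... | _ , false , _ , zeros = inj₁ (Parsing.sameFactors free noPairs (zeros⇒no-ones free noPairs zeros))
... | _ , true , _ , ones = inj₂ (sameFactors-compl hfib (Parsing.sameFactors free′ noPairs′ (zeros⇒no-ones free′ noPairs′ (doubleAt-compl {w} ones))))
  where
  free′ : ElevenThirdsFree (complZ w)
  free′ = elevenThirdsFree-compl free
  noPairs′ : NoComplementaryPairs4 (complZ w)
  noPairs′ = noComplementaryPairs4-compl noPairs
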